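{- Let $\{a,b,c\}$ be a Diophantine triple (i.e.\ a $D(1)$-set) such that $a+b+c$ is even and $c\neq a+b\pm 2\sqrt{ab+1}$ (for either choice of sign). Then $\{a,b,c\}$ is also a $D(n)$-set for some integer $n\neq 1$ (namely $n=\frac14(a+b+c)^2-ab-ac-bc$).
   Context: For a nonzero integer $n$, a $D(n)$-set is a set of distinct nonzero integers $\{a_1,\dots,a_m\}$ such that $a_ia_j+n$ is a perfect square for all $1\le i<j\le m$. A Diophantine triple is a $D(1)$-set with three elements. -}

module Defs where

open import Data.Integer using (ℤ; _*_; _+_; +_)
open import Data.Product using (∃; _×_)
open import Data.List using (List)
open import Data.List.Relation.Unary.All using (All)
open import Data.List.Relation.Unary.AllPairs using (AllPairs)
open import Relation.Binary.PropositionalEquality using (_≡_; _≢_)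

IsSquare : ℤ → Set
IsSquare x = ∃ λ k → k * k ≡ x

IsDSet : ℤ → List ℤ → Set
IsDSet n xs =
  n ≢ + 0 ×
  AllPairs _≢_ xs ×
  All (λ x → x ≢ + 0) xs ×
  AllPairs (λ x y → IsSquare (x * y + n)) xs

module Submission where

-- Write a + b + c = 2s (possible because the sum is even) and
-- put n = s² − (ab + ac + bc), so that 4n = (a+b+c)² − 4(ab+ac+bc).  When
-- c = 2s − a − b the three products are shifted onto squares by n:
--   ab + n = (s − a − b)²,   ac + n = (s − b)²,   bc + n = (s − a)²,
-- so {a,b,c} is a D(n)-set as soon as n ≠ 0.
--   * n ≠ 1: otherwise r = s − a − b satisfies r² = ab + 1 and
--     c = a + b + 2r, which the hypothesis excludes.
--   * n ≠ 0: otherwise (s − a − b)² = ab while ab + 1 is a square k², and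
--     two integer squares never differ by 1 unless the smaller is 0; hence
--     ab = 0, contradicting that a and b are nonzero.

open import Defs
open import Data.Nat as ℕ using (suc; s≤s; z≤n)
import Data.Nat.Properties as ℕP
import Data.Nat.Tactic.RingSolver as ℕSolver
open import Data.Integer using (ℤ; _*_; _+_; _-_; +_; -[1+_]; ∣_∣)
import Data.Integer.Properties as ℤP
import Data.Integer.Tactic.RingSolver as ℤSolver
open import Data.Integer.Divisibility using (_∣_)
open import Data.Integer.Divisibility.Signed using (divides; ∣ᵤ⇒∣)
open import Data.List using (_∷_; [])
open import Data.Product using (∃; _×_; _,_)
open import Data.Sum using (inj₁; inj₂)
open import Data.Empty using (⊥; ⊥-elim)
open import Relation.Binary.PropositionalEquality
  using (_≡_; _≢_; refl; sym; trans; cong; module ≡-Reasoning)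

no-square-between : ∀ K T → T ℕ.* T ℕ.< K ℕ.* K → K ℕ.* K ℕ.< suc T ℕ.* suc T → ⊥
no-square-between K T below above with ℕP.≤-<-connex K T
... | inj₁ K≤T = ℕP.<-irrefl refl (ℕP.<-≤-trans below (ℕP.*-mono-≤ K≤T K≤T))
... | inj₂ T<K = ℕP.<-irrefl refl (ℕP.<-≤-trans above (ℕP.*-mono-≤ T<K T<K))

-- (T+1)² = T² + 1 + 2T; the extra 2T is what separates T² + 1 from the next square.
square-suc : ∀ T → suc T ℕ.* suc T ≡ T ℕ.* T ℕ.+ 1 ℕ.+ (T ℕ.+ T)
square-suc = ℕSolver.solve-∀

consecutive-squaresℕ : ∀ K T → K ℕ.* K ≡ T ℕ.* T ℕ.+ 1 → T ≡ 0
consecutive-squaresℕ K 0       _  = refl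
consecutive-squaresℕ K T@(suc _) eq = ⊥-elim (no-square-between K T below above)
  where
  below : T ℕ.* T ℕ.< K ℕ.* K
  below = ℕP.≤-reflexive (trans (ℕP.+-comm 1 (T ℕ.* T)) (sym eq))
  above : K ℕ.* K ℕ.< suc T ℕ.* suc T
  above = ℕP.<-≤-trans (ℕP.m<m+n (K ℕ.* K) (s≤s z≤n))
            (ℕP.≤-reflexive (trans (cong (ℕ._+ (T ℕ.+ T)) eq) (sym (square-suc T))))

square≡abs-square : ∀ t → t * t ≡ + (∣ t ∣ ℕ.* ∣ t ∣)
square≡abs-square (+ n)    = sym (ℤP.pos-* n n)
square≡abs-square -[1+ n ] = refl

consecutive-squares : ∀ k t → k * k ≡ t * t + + 1 → t ≡ + 0
consecutive-squares k t eq = ℤP.∣i∣≡0⇒i≡0 (consecutive-squaresℕ ∣ k ∣ ∣ t ∣ (begin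
    ∣ k ∣ ℕ.* ∣ k ∣    ≡⟨ sym (ℤP.abs-* k k) ⟩
    ∣ k * k ∣          ≡⟨ cong ∣_∣ eq ⟩
    ∣ t * t + + 1 ∣    ≡⟨ cong (λ z → ∣ z + + 1 ∣) (square≡abs-square t) ⟩
    ∣ t ∣ ℕ.* ∣ t ∣ ℕ.+ 1 ∎))
  where open ≡-Reasoning

third≡ : ∀ a b c s → a + b + c ≡ s * + 2 → c ≡ s * + 2 - a - b
third≡ a b c s sum = begin
  c                  ≡⟨ ℤSolver.solve (a ∷ b ∷ c ∷ []) ⟩
  a + b + c - a - b  ≡⟨ cong (λ σ → σ - a - b) sum ⟩
  s * + 2 - a - b    ∎
  where open ≡-Reasoning

four-shift : ∀ a b c s → c ≡ s * + 2 - a - b →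
  + 4 * (s * s - (a * b + a * c + b * c)) ≡ (a + b + c) * (a + b + c) - + 4 * (a * b + a * c + b * c)
four-shift a b _ s refl = ℤSolver.solve (a ∷ b ∷ s ∷ [])

shift-ab : ∀ a b c s → c ≡ s * + 2 - a - b → (s - a - b) * (s - a - b) ≡ a * b + (s * s - (a * b + a * c + b * c))
shift-ab a b _ s refl = ℤSolver.solve (a ∷ b ∷ s ∷ [])

shift-ac : ∀ a b c s → c ≡ s * + 2 - a - b → (s - b) * (s - b) ≡ a * c + (s * s - (a * b + a * c + b * c))
shift-ac a b _ s refl = ℤSolver.solve (a ∷ b ∷ s ∷ [])

shift-bc : ∀ a b c s → c ≡ s * + 2 - a - b → (s - a) * (s - a) ≡ b * c + (s * s - (a * b + a * c + b * c))
shift-bc a b _ s refl = ℤSolver.solve (a ∷ b ∷ s ∷ [])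

third≡sum+twice-gap : ∀ a b c s → c ≡ s * + 2 - a - b → c ≡ a + b + + 2 * (s - a - b)
third≡sum+twice-gap a b _ s refl = ℤSolver.solve (a ∷ b ∷ s ∷ [])

product-not-square : ∀ a b k t → a ≢ + 0 → b ≢ + 0 → k * k ≡ a * b + + 1 → t * t ≢ a * b
product-not-square a b k t a≢0 b≢0 k²≡ab+1 t²≡ab with ℤP.i*j≡0⇒i≡0∨j≡0 a ab≡0
  where
  t≡0 : t ≡ + 0
  t≡0 = consecutive-squares k t (trans k²≡ab+1 (cong (_+ + 1) (sym t²≡ab)))
  ab≡0 : a * b ≡ + 0
  ab≡0 = trans (sym t²≡ab) (cong (λ z → z * z) t≡0)
... | inj₁ a≡0 = a≢0 a≡0
... | inj₂ b≡0 = b≢0 b≡0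

-- The constructors of All/AllPairs (used to take apart and assemble D(n)-sets)
-- are brought into scope only here, so that list literals above stay unambiguous.
open import Data.List.Relation.Unary.All using (_∷_; [])
open import Data.List.Relation.Unary.AllPairs using (_∷_; [])

corollary1 : (a b c : ℤ) → IsDSet (+ 1) (a ∷ b ∷ c ∷ []) →
    + 2 ∣ (a + b + c) →
    (∀ r → r * r ≡ a * b + + 1 → c ≢ a + b + + 2 * r) →
    ∃ λ n → + 4 * n ≡ (a + b + c) * (a + b + c) - + 4 * (a * b + a * c + b * c) ×
    n ≢ + 1 × IsDSet n (a ∷ b ∷ c ∷ [])
corollary1 a b c (_ , distinct , nonzero@(a≢0 ∷ b≢0 ∷ _) , ((k , k²≡ab+1) ∷ _) ∷ _) even hyp
  with divides s sum ← ∣ᵤ⇒∣ even =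
  n , four-shift a b c s c≡ , n≢1 , n≢0 , distinct , nonzero ,
  ((gap , ab+n) ∷ (s - b , ac+n) ∷ []) ∷ ((s - a , bc+n) ∷ []) ∷ [] ∷ []
  where
  n : ℤ
  n = s * s - (a * b + a * c + b * c)
  gap : ℤ
  gap = s - a - b
  c≡ : c ≡ s * + 2 - a - b
  c≡ = third≡ a b c s sum
  ab+n : gap * gap ≡ a * b + n
  ab+n = shift-ab a b c s c≡
  ac+n : (s - b) * (s - b) ≡ a * c + n
  ac+n = shift-ac a b c s c≡
  bc+n : (s - a) * (s - a) ≡ b * c + n
  bc+n = shift-bc a b c s c≡
  n≢1 : n ≢ + 1
  n≢1 n≡1 = hyp gap (trans ab+n (cong (λ m → a * b + m) n≡1)) (third≡sum+twice-gap a b c s c≡)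
  n≢0 : n ≢ + 0
  n≢0 n≡0 = product-not-square a b k gap a≢0 b≢0 k²≡ab+1
    (trans ab+n (trans (cong (λ m → a * b + m) n≡0) (ℤP.+-identityʳ (a * b))))
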